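{- Let $k\equiv3\pmod4$, and let $A$ be a cyclically almost $k$-diagonal array of size $n>k$ in standard form. Suppose its extra filled position is $(1,\ell)$ with $\ell$ odd. If $\gcd(n,k-1)=2$, then the following is a solution of $P(A)$: $R=(1,\dots,1)$, and $C\in\{ -1,1\}^n$ with $c_2=c_\ell=-1$ and $c_j=1$ for all other $j$.
   Context: Arrays are toroidal: an $n\times n$ array has rows and columns indexed modulo $n$ (representatives $1,\dots,n$). Each cell is filled or empty; $F(A)$ is the set of filled cells. For $(i,j)\in F(A)$: - the row successor $s_r((i,j))$ is $(i,j+k)$ with $k\ge1$ minimal such that $(i,j+k)\in F(A)$; - the column successor $s_c((i,j))$ is $(i+k,j)$ with $k\ge1$ minimal such that $(i+k,j)\in F(A)$. Given $R,C\in\{ -1,1\}^n$, the move function is $S_{R,C}((i,j))=s_c^{\,c_{j'}}((i,j'))$, where $(i,j')=s_r^{\,r_i}((i,j))$; exponent $-1$ means inverse. $R,C$ is a solution of $P(A)$ if $S_{R,C}$ is a single cycle on $F(A)$. Diagonals: $D_i=\{(i+t-1,t): t=1,\dots,n\}$, with row indices modulo $n$. A cyclically almost $k$-diagonal array of size $n>k$ is a square array whose filled cells are exactly the cells of $k$ diagonals consecutive modulo $n$, plus one extra filled cell lying in another diagonal. Standard form: such an array is in standard form if the $k$ totally filled diagonals are $D_1,\dots,D_k$ and the extra filled cell is $(1,\ell)$ with $2\le\ell\le n-k+1$. -}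

module Defs where

open import Data.Nat using (ℕ; zero; suc; _+_; _∸_; _<_; _≤_; _≡ᵇ_; NonZero)
open import Data.Nat.DivMod using (_mod_; _%_)
open import Data.Fin using (Fin; toℕ)
open import Data.Bool using (Bool; true; false; if_then_else_; _∨_)
open import Data.Product using (_×_; _,_; ∃)
open import Data.Sum using (_⊎_)
open import Data.Sign using (Sign) renaming (+ to ⊕; - to ⊖)
open import Function.Bundles using (_⇔_)
open import Relation.Binary.PropositionalEquality using (_≡_)

-- Conventions: the paper's 1-based index p (mod n) is represented by the
-- 0-based element p-1 of Fin n.  An n×n toroidal array is a Bool-valued
-- function: A i j ≡ true iff cell (i,j) is filled.

Array : ℕ → Set
Array n = Fin n → Fin n → Bool

Cell : ℕ → Set
Cell n = Fin n × Fin n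

Filled : ∀ {n} → Array n → Cell n → Set
Filled A (i , j) = A i j ≡ true

module _ {n : ℕ} .{{_ : NonZero n}} where

  -- j + k  and  j - k  (mod n), the latter for 0 ≤ k ≤ n
  fwd : Fin n → ℕ → Fin n
  fwd j k = (toℕ j + k) mod n

  bwd : Fin n → ℕ → Fin n
  bwd j k = (toℕ j + n ∸ k) mod n

  -- least k in {start, start+1, ..., start+fuel-1} with p k ≡ true
  -- (returns start+fuel if none)
  firstFrom : (ℕ → Bool) → ℕ → ℕ → ℕ
  firstFrom p k zero = k
  firstFrom p k (suc f) = if p k then k else firstFrom p (suc k) f

  leastPos : (ℕ → Bool) → ℕ
  leastPos p = firstFrom p 1 n

  sr : Array n → Cell n → Cell n
  sr A (i , j) = i , fwd j (leastPos (λ k → A i (fwd j k)))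

  srInv : Array n → Cell n → Cell n
  srInv A (i , j) = i , bwd j (leastPos (λ k → A i (bwd j k)))

  sc : Array n → Cell n → Cell n
  sc A (i , j) = fwd i (leastPos (λ k → A (fwd i k) j)) , j

  scInv : Array n → Cell n → Cell n
  scInv A (i , j) = bwd i (leastPos (λ k → A (bwd i k) j)) , j

  rowPow : Array n → Sign → Cell n → Cell n
  rowPow A ⊕ = sr A
  rowPow A ⊖ = srInv A

  colPow : Array n → Sign → Cell n → Cell n
  colPow A ⊕ = sc A
  colPow A ⊖ = scInv A

  move : Array n → (Fin n → Sign) → (Fin n → Sign) → Cell n → Cell n
  move A R C (i , j) with rowPow A (R i) (i , j)
  ... | (i' , j') = colPow A (C j') (i' , j')

iter : ∀ {X : Set} → (X → X) → ℕ → X → X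
iter f zero x = x
iter f (suc m) x = f (iter f m x)

-- S (a permutation of F(A)) is a single cycle on F(A): every filled cell
-- is reached from every filled cell by iterating S.
SingleCycle : ∀ {n} → Array n → (Cell n → Cell n) → Set
SingleCycle A S = ∀ x y → Filled A x → Filled A y → ∃ λ m → iter S m x ≡ y

IsSolution : ∀ {n} .{{_ : NonZero n}} → Array n → (Fin n → Sign) → (Fin n → Sign) → Set
IsSolution A R C = SingleCycle A (move A R C)

-- 0-based diagonal index of cell (r,c): cell lies in D_{d+1} where
-- d = (r - c) mod n.  (D_i = {(i+t-1,t)} in 1-based indexing.)
diagIdx : ∀ {n} .{{_ : NonZero n}} → Fin n → Fin n → ℕ
diagIdx {n} r c = (toℕ r + n ∸ toℕ c) % n

StandardForm : ∀ {n} .{{_ : NonZero n}} → (k ℓ : ℕ) → Array n → Set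
StandardForm {n} k ℓ A =
  k < n × 2 ≤ ℓ × ℓ ≤ n ∸ k + 1 ×
  (∀ r c → (A r c ≡ true) ⇔ (diagIdx r c < k ⊎ (toℕ r ≡ 0 × toℕ c ≡ ℓ ∸ 1)))

allPlus : ∀ {n} → Fin n → Sign
allPlus _ = ⊕

colSigns : ∀ {n} → ℕ → Fin n → Sign
colSigns ℓ j = if (toℕ j ≡ᵇ 1) ∨ (toℕ j ≡ᵇ ℓ ∸ 1) then ⊖ else ⊕

module Submission where

open import Defs
open import Data.Nat using (ℕ; NonZero)
open import Data.Nat.DivMod using (_%_)
open import Data.Nat.GCD using (gcd)
open import Data.Nat using (_∸_)
open import Relation.Binary.PropositionalEquality using (_≡_)
open import Data.Nat
open import Data.Nat.Properties
open import Data.Nat.DivMod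
open import Data.Nat.Divisibility
open import Data.Nat.GCD
open import Data.Nat.Tactic.RingSolver using (solve-∀)
open import Data.Fin using (Fin; toℕ)
open import Data.Fin.Properties using (toℕ-injective; toℕ<n; toℕ-fromℕ<)
open import Data.Bool using (Bool; true; false)
open import Data.Bool.Properties using (T-≡; ∨-zeroʳ)
open import Data.Product using (_×_; _,_; ∃; proj₁; proj₂)
open import Data.Sum using (_⊎_; inj₁; inj₂) renaming (map to ⊎-map)
open import Data.Empty using (⊥-elim)
open import Data.Sign using (Sign) renaming (+ to ⊕; - to ⊖)
open import Function.Bundles using (_⇔_; Equivalence)
open import Relation.Nullary using (¬_; yes; no)
open import Relation.Binary.Definitions using (tri<; tri≈; tri>)
open import Relation.Binary.PropositionalEquality

-- We work 0-based in diagonal coordinates: K = k - 1, L = ℓ - 1 (even),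
-- T = n - K, and `cell d c` is the cell of diagonal d in column c.
--   * Arithmetic modulo n, and a search lemma computing sr, sc and sc⁻¹.
--   * The translation orbit c ↦ c + T of ℤ/n: since gcd(n, T) = gcd(n, K) = 2
--     it has period n/2 and runs through a whole parity class.
--   * The move table of S: on diagonals d ≥ 1, S advances one column, except
--     that on reaching column 1 or L (sign -1) it descends two diagonals; on
--     diagonal 0 it jumps c ↦ c + T, leaving diagonal 0 at columns 1 and L
--     and through the corner (0,0), from where it passes the extra cell.
--   * The tour: each diagonal d ≥ 1 splits into a left (columns 1 … L - 1)
--     and a right segment (L … n); S runs through them in laps, two diagonals
--     down and switching sides.  As K ≡ 2 (mod 4), these laps and the odd
--     and even orbits on diagonal 0 close up into one walk through a hub
--     cell, and every filled cell lies on it: S is a single cycle.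

+-rightComm : ∀ a b c → a + b + c ≡ a + c + b
+-rightComm a b c = trans (+-assoc a b c) (trans (cong (a +_) (+-comm b c)) (sym (+-assoc a c b)))

module Congruence (n : ℕ) {{_ : NonZero n}} where

  infix 4 _≋_
  _≋_ : ℕ → ℕ → Set
  a ≋ b = a % n ≡ b % n

  ≡⇒≋ : ∀ {a b} → a ≡ b → a ≋ b
  ≡⇒≋ = cong (_% n)

  %-≋ : ∀ a → a % n ≋ a
  %-≋ a = m%n%n≡m%n a n

  +-≋ : ∀ {a b c d} → a ≋ b → c ≋ d → a + c ≋ b + d
  +-≋ {a} {b} {c} {d} a≋b c≋d = begin
      (a + c) % n           ≡⟨ %-distribˡ-+ a c n ⟩
      (a % n + c % n) % n   ≡⟨ cong₂ (λ x y → (x + y) % n) a≋b c≋d ⟩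
      (b % n + d % n) % n   ≡⟨ %-distribˡ-+ b d n ⟨
      (b + d) % n           ∎
    where open ≡-Reasoning

  +-≋ˡ : ∀ {a b} c → a ≋ b → a + c ≋ b + c
  +-≋ˡ c a≋b = +-≋ a≋b refl

  +-≋ʳ : ∀ a {b c} → b ≋ c → a + b ≋ a + c
  +-≋ʳ a b≋c = +-≋ {a} {a} refl b≋c

  +kn-≋ : ∀ a k → a + k * n ≋ a
  +kn-≋ a k = [m+kn]%n≡m%n a k n

  +n-≋ : ∀ a → a + n ≋ a
  +n-≋ a = [m+n]%n≡m%n a n

  -- Addition is cancellable: add the complement of c to both sides.
  ≋-cancelʳ : ∀ {a b} c → a + c ≋ b + c → a ≋ b
  ≋-cancelʳ {a} {b} c a+c≋b+c = trans (sym (complement a)) (trans shifted (complement b))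
    where
    c′ = n ∸ c % n
    c+c′ : c % n + c′ ≡ n
    c+c′ = m+[n∸m]≡n (<⇒≤ (m%n<n c n))
    complement : ∀ x → x + c + c′ ≋ x
    complement x = begin
        (x + c + c′) % n         ≡⟨ ≡⇒≋ (+-assoc x c c′) ⟩
        (x + (c + c′)) % n       ≡⟨ +-≋ʳ x (+-≋ˡ c′ (sym (%-≋ c))) ⟩
        (x + (c % n + c′)) % n   ≡⟨ ≡⇒≋ (cong (x +_) c+c′) ⟩
        (x + n) % n              ≡⟨ +n-≋ x ⟩
        x % n                    ∎
      where open ≡-Reasoning
    shifted : a + c + c′ ≋ b + c + c′
    shifted = +-≋ˡ c′ a+c≋b+c

  ≋⇒≡ : ∀ {a b} → a < n → b < n → a ≋ b → a ≡ b
  ≋⇒≡ a<n b<n a≋b = trans (sym (m<n⇒m%n≡m a<n)) (trans a≋b (m<n⇒m%n≡m b<n))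

  toℕ-mod : ∀ a → toℕ (a mod n) ≡ a % n
  toℕ-mod a = toℕ-fromℕ< (m%n<n a n)

  toℕ-mod-≋ : ∀ a → toℕ (a mod n) ≋ a
  toℕ-mod-≋ a = trans (≡⇒≋ (toℕ-mod a)) (%-≋ a)

  toℕ-mod-< : ∀ {a} → a < n → toℕ (a mod n) ≡ a
  toℕ-mod-< {a} a<n = trans (toℕ-mod a) (m<n⇒m%n≡m a<n)

  ≋0⇒∣ : ∀ {a} → a ≋ 0 → n ∣ a
  ≋0⇒∣ {a} a≋0 = m%n≡0⇒n∣m a n (trans a≋0 (m<n⇒m%n≡m (>-nonZero⁻¹ n)))

  ≋⇒mod-≡ : ∀ {a b} → a ≋ b → a mod n ≡ b mod n
  ≋⇒mod-≡ {a} {b} a≋b = toℕ-injective (trans (toℕ-mod a) (trans a≋b (sym (toℕ-mod b))))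

  diagIdx-≋ : ∀ (r c : Fin n) D → D < n → toℕ c + D ≋ toℕ r → diagIdx r c ≡ D
  diagIdx-≋ r c D D<n c+D≋r = trans (≋-cancelʳ (toℕ c) shift) (m<n⇒m%n≡m D<n)
    where
    X = toℕ r + n ∸ toℕ c
    X+c : X + toℕ c ≡ toℕ r + n
    X+c = m∸n+n≡m (≤-trans (<⇒≤ (toℕ<n c)) (m≤n+m n (toℕ r)))
    shift : X + toℕ c ≋ D + toℕ c
    shift = begin
        (X + toℕ c) % n   ≡⟨ ≡⇒≋ X+c ⟩
        (toℕ r + n) % n   ≡⟨ +n-≋ (toℕ r) ⟩
        toℕ r % n         ≡⟨ c+D≋r ⟨
        (toℕ c + D) % n   ≡⟨ ≡⇒≋ (+-comm (toℕ c) D) ⟩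
        (D + toℕ c) % n   ∎
      where open ≡-Reasoning

module _ {n : ℕ} .{{_ : NonZero n}} where

  firstFrom-first : (p : ℕ → Bool) (t : ℕ) → ∀ f k → k ≤ t → t < k + f → p t ≡ true →
                    (∀ s → k ≤ s → s < t → p s ≡ false) → firstFrom {n} p k f ≡ t
  firstFrom-first p t zero k k≤t t<k+0 _ _ =
    ⊥-elim (<⇒≱ (subst (t <_) (+-identityʳ k) t<k+0) k≤t)
  firstFrom-first p t (suc f) k k≤t t<k+f pt miss with k ≟ t
  ... | yes refl rewrite pt = refl
  ... | no k≢t rewrite miss k ≤-refl (≤∧≢⇒< k≤t k≢t) =
    firstFrom-first p t f (suc k) (≤∧≢⇒< k≤t k≢t) (subst (t <_) (+-suc k f) t<k+f) pt
      (λ s k<s s<t → miss s (<⇒≤ k<s) s<t)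

  leastPos-first : (p : ℕ → Bool) (t : ℕ) → 1 ≤ t → t ≤ n → p t ≡ true →
                   (∀ s → 1 ≤ s → s < t → p s ≡ false) → leastPos {n} p ≡ t
  leastPos-first p t 1≤t t≤n = firstFrom-first p t n 1 1≤t (s≤s t≤n)

  module _ (A : Array n) (i j : Fin n) (t : ℕ) (1≤t : 1 ≤ t) (t≤n : t ≤ n) where

    sr-at : A i (fwd j t) ≡ true → (∀ s → 1 ≤ s → s < t → A i (fwd j s) ≡ false) →
            sr A (i , j) ≡ (i , fwd j t)
    sr-at hit miss = cong (λ x → i , fwd j x) (leastPos-first _ t 1≤t t≤n hit miss)

    sc-at : A (fwd i t) j ≡ true → (∀ s → 1 ≤ s → s < t → A (fwd i s) j ≡ false) →
            sc A (i , j) ≡ (fwd i t , j)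
    sc-at hit miss = cong (λ x → fwd i x , j) (leastPos-first _ t 1≤t t≤n hit miss)

    scInv-at : A (bwd i t) j ≡ true → (∀ s → 1 ≤ s → s < t → A (bwd i s) j ≡ false) →
               scInv A (i , j) ≡ (bwd i t , j)
    scInv-at hit miss = cong (λ x → bwd i x , j) (leastPos-first _ t 1≤t t≤n hit miss)

gcd-complement : ∀ {n T K} → T + K ≡ n → gcd n T ≡ gcd n K
gcd-complement {n} {T} {K} T+K≡n = ∣-antisym (divides-other T+K≡n) (divides-other (trans (+-comm K T) T+K≡n))
  where
  divides-other : ∀ {a b} → a + b ≡ n → gcd n a ∣ gcd n b
  divides-other {a} {b} a+b≡n = gcd-greatest (gcd[m,n]∣m n a)
    (∣m+n∣m⇒∣n (subst (gcd n a ∣_) (sym a+b≡n) (gcd[m,n]∣m n a)) (gcd[m,n]∣n n a))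

module TranslationOrbit (n T : ℕ) {{n-nonZero : NonZero n}} (gcd≡2 : gcd n T ≡ 2) where

  open Congruence n

  orbit : ℕ → ℕ → ℕ
  orbit b t = (b + t * T) % n

  orbit-< : ∀ b t → orbit b t < n
  orbit-< b t = m%n<n _ n

  orbit-zero : ∀ {b} → b < n → orbit b 0 ≡ b
  orbit-zero {b} b<n = trans (cong (_% n) (+-identityʳ b)) (m<n⇒m%n≡m b<n)

  orbit-suc : ∀ b t → (orbit b t + T) % n ≡ orbit b (suc t)
  orbit-suc b t = trans (+-≋ˡ T (%-≋ (b + t * T))) (≡⇒≋ (reassoc b t T))
    where reassoc : ∀ b t T → b + t * T + T ≡ b + (T + t * T)
          reassoc = solve-∀

  orbit-suc-≋ : ∀ b t → orbit b t + T ≋ orbit b (suc t)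
  orbit-suc-≋ b t = trans (orbit-suc b t) (sym (m<n⇒m%n≡m (orbit-< b (suc t))))

  2∣n : 2 ∣ n
  2∣n = subst (_∣ n) gcd≡2 (gcd[m,n]∣m n T)

  2∣T : 2 ∣ T
  2∣T = subst (_∣ T) gcd≡2 (gcd[m,n]∣n n T)

  half : ℕ
  half = quotient 2∣n

  n≡half*2 : n ≡ half * 2
  n≡half*2 = _∣_.equality 2∣n

  instance
    half-nonZero : NonZero half
    half-nonZero = m*n≢0⇒m≢0 half {{subst NonZero n≡half*2 n-nonZero}}

  -- Adding multiples of the even step T keeps the parity (n is even too).
  orbit-parity : ∀ b t → orbit b t % 2 ≡ b % 2
  orbit-parity b t = trans (m∣n⇒o%n%m≡o%m 2 n (b + t * T) 2∣n)
                           (%-remove-+ʳ b (∣n⇒∣m*n t 2∣T))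

  -- Period n/2: half steps add half · T = (T/2) · n.
  orbit-period : ∀ b t k → orbit b (t + k * half) ≡ orbit b t
  orbit-period b t k = trans (≡⇒≋ regroup) (+kn-≋ (b + t * T) (k * quotient 2∣T))
    where
    T₂ = quotient 2∣T
    expand : ∀ b t k h T₂ → b + (t + k * h) * (T₂ * 2) ≡ (b + t * (T₂ * 2)) + (k * T₂) * (h * 2)
    expand = solve-∀
    regroup : b + (t + k * half) * T ≡ (b + t * T) + (k * T₂) * n
    regroup = begin
        b + (t + k * half) * T                         ≡⟨ cong (λ X → b + (t + k * half) * X) (_∣_.equality 2∣T) ⟩
        b + (t + k * half) * (T₂ * 2)                   ≡⟨ expand b t k half T₂ ⟩
        (b + t * (T₂ * 2)) + (k * T₂) * (half * 2)      ≡⟨ cong₂ (λ X Y → (b + t * X) + (k * T₂) * Y) (sym (_∣_.equality 2∣T)) (sym n≡half*2) ⟩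
        (b + t * T) + (k * T₂) * n                      ∎
      where open ≡-Reasoning

  orbit-half : ∀ {b} → b < n → orbit b half ≡ b
  orbit-half {b} b<n = trans (cong (orbit b) (sym (+-identityʳ half)))
                             (trans (orbit-period b 0 1) (orbit-zero b<n))

  -- If u steps return to the same residue then n ∣ u * gcd n T = 2u, so n/2 ∣ u.
  return-time : ∀ b s u → orbit b (s + u) ≡ orbit b s → half ∣ u
  return-time b s u returns = *-cancelʳ-∣ 2 (subst (_∣ u * 2) n≡half*2 n∣2u)
    where
    shifted : u * T + (b + s * T) ≋ 0 + (b + s * T)
    shifted = trans (≡⇒≋ (reorder b s u T)) returns
      where reorder : ∀ b s u T → u * T + (b + s * T) ≡ b + (s + u) * T
            reorder = solve-∀
    n∣uT : n ∣ u * T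
    n∣uT = ≋0⇒∣ (≋-cancelʳ (b + s * T) shifted)
    n∣2u : n ∣ u * 2
    n∣2u = subst (n ∣_) (trans (sym (c*gcd[m,n]≡gcd[cm,cn] u n T)) (cong (u *_) gcd≡2))
                 (gcd-greatest (n∣m*n u) n∣uT)

  orbit-injective : ∀ b {s s′} → s < s′ → s′ < half → orbit b s ≢ orbit b s′
  orbit-injective b {s} {s′} s<s′ s′<half same =
    <⇒≱ (≤-<-trans (m∸n≤m s′ s) s′<half) (∣⇒≤ {{>-nonZero (m<n⇒0<n∸m s<s′)}} half∣gap)
    where
    half∣gap : half ∣ s′ ∸ s
    half∣gap = return-time b s (s′ ∸ s) (trans (cong (orbit b) (m+[n∸m]≡n (<⇒≤ s<s′))) (sym same))

  orbit-cancel : ∀ b {s s′} → s < half → s′ < half → orbit b s ≡ orbit b s′ → s ≡ s′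
  orbit-cancel b {s} {s′} s<half s′<half same with <-cmp s s′
  ... | tri< s<s′ _ _ = ⊥-elim (orbit-injective b s<s′ s′<half same)
  ... | tri≈ _ s≡s′ _ = s≡s′
  ... | tri> _ _ s′<s = ⊥-elim (orbit-injective b s′<s s<half (sym same))

  even-offset : ∀ {b c} → b < n → c % 2 ≡ b % 2 → ∃ λ e → b + e * 2 ≋ c
  even-offset {b} {c} b<n same-parity = c / 2 + (half ∸ b / 2) , trans (≡⇒≋ b+2e≡c+n) (+n-≋ c)
    where
    b/2<half : b / 2 < half
    b/2<half = m<n*o⇒m/o<n (subst (b <_) n≡half*2 b<n)
    regroup : ∀ r qb qc x → r + qb * 2 + (qc + x) * 2 ≡ (r + qc * 2) + (qb + x) * 2
    regroup = solve-∀
    b+2e≡c+n : b + (c / 2 + (half ∸ b / 2)) * 2 ≡ c + n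
    b+2e≡c+n = begin
        b + (c / 2 + (half ∸ b / 2)) * 2
          ≡⟨ cong (_+ (c / 2 + (half ∸ b / 2)) * 2) (m≡m%n+[m/n]*n b 2) ⟩
        b % 2 + b / 2 * 2 + (c / 2 + (half ∸ b / 2)) * 2
          ≡⟨ regroup (b % 2) (b / 2) (c / 2) (half ∸ b / 2) ⟩
        (b % 2 + c / 2 * 2) + (b / 2 + (half ∸ b / 2)) * 2
          ≡⟨ cong₂ (λ X Y → (X + c / 2 * 2) + Y * 2) (sym same-parity) (m+[n∸m]≡n (<⇒≤ b/2<half)) ⟩
        (c % 2 + c / 2 * 2) + half * 2
          ≡⟨ cong₂ _+_ (sym (m≡m%n+[m/n]*n c 2)) (sym n≡half*2) ⟩
        c + n ∎
      where open ≡-Reasoning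

  -- Bézout for gcd n T = 2: every even residue is a multiple of T.
  multiple-of-T : ∀ e → ∃ λ t → t * T ≋ e * 2
  multiple-of-T e with subst (λ d → Bézout.Identity d n T) gcd≡2 (Bézout.identity (gcd-GCD n T))
  ... | Bézout.-+ x y 2+xn≡yT = e * y , (begin
        (e * y * T) % n         ≡⟨ ≡⇒≋ (trans (*-assoc e y T) (cong (e *_) (sym 2+xn≡yT))) ⟩
        (e * (2 + x * n)) % n   ≡⟨ ≡⇒≋ (distrib e x n) ⟩
        (e * 2 + e * x * n) % n ≡⟨ +kn-≋ (e * 2) (e * x) ⟩
        (e * 2) % n             ∎)
    where open ≡-Reasoning
          distrib : ∀ e x n → e * (2 + x * n) ≡ e * 2 + e * x * n
          distrib = solve-∀
  ... | Bézout.+- x y 2+yT≡xn = e * pred n * y , (begin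
        (t * T) % n                          ≡⟨ +kn-≋ (t * T) (e * 2) ⟨
        (t * T + e * 2 * n) % n              ≡⟨ ≡⇒≋ (cong (λ N → t * T + e * 2 * N) (sym (suc-pred n))) ⟩
        (t * T + e * 2 * suc (pred n)) % n   ≡⟨ ≡⇒≋ (regroup e (pred n) y T) ⟩
        (e * 2 + e * pred n * (2 + y * T)) % n
          ≡⟨ ≡⇒≋ (cong (λ X → e * 2 + e * pred n * X) 2+yT≡xn) ⟩
        (e * 2 + e * pred n * (x * n)) % n   ≡⟨ ≡⇒≋ (cong (e * 2 +_) (sym (*-assoc (e * pred n) x n))) ⟩
        (e * 2 + e * pred n * x * n) % n     ≡⟨ +kn-≋ (e * 2) (e * pred n * x) ⟩
        (e * 2) % n                          ∎)
    where open ≡-Reasoning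
          t = e * pred n * y
          regroup : ∀ e m y T → e * m * y * T + e * 2 * suc m ≡ e * 2 + e * m * (2 + y * T)
          regroup = solve-∀

  orbit-onto : ∀ {b c} → b < n → c < n → c % 2 ≡ b % 2 → ∃ λ t → t < half × orbit b t ≡ c
  orbit-onto {b} {c} b<n c<n same-parity with even-offset b<n same-parity
  ... | e , b+2e≋c with multiple-of-T e
  ... | t , tT≋2e = t % half , m%n<n t half , (begin
        orbit b (t % half)                   ≡⟨ orbit-period b (t % half) (t / half) ⟨
        orbit b (t % half + t / half * half) ≡⟨ cong (orbit b) (sym (m≡m%n+[m/n]*n t half)) ⟩
        orbit b t                            ≡⟨ trans (+-≋ʳ b tT≋2e) b+2e≋c ⟩
        c % n                                ≡⟨ m<n⇒m%n≡m c<n ⟩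
        c                                    ∎)
    where open ≡-Reasoning

≡ᵇ-true : ∀ {m n} → m ≡ n → (m ≡ᵇ n) ≡ true
≡ᵇ-true {m} {n} m≡n = Equivalence.to T-≡ (≡⇒≡ᵇ m n m≡n)

≡ᵇ-false : ∀ {m n} → m ≢ n → (m ≡ᵇ n) ≡ false
≡ᵇ-false {m} {n} m≢n with m ≡ᵇ n in eq
... | false = refl
... | true = ⊥-elim (m≢n (≡ᵇ⇒≡ m n (Equivalence.from T-≡ eq)))

colSigns-plus : ∀ {n} ℓ (j : Fin n) → toℕ j ≢ 1 → toℕ j ≢ ℓ ∸ 1 → colSigns ℓ j ≡ ⊕
colSigns-plus ℓ j j≢1 j≢ℓ rewrite ≡ᵇ-false j≢1 | ≡ᵇ-false j≢ℓ = refl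

colSigns-minus : ∀ {n} ℓ (j : Fin n) → toℕ j ≡ 1 ⊎ toℕ j ≡ ℓ ∸ 1 → colSigns ℓ j ≡ ⊖
colSigns-minus ℓ j (inj₁ j≡1) rewrite ≡ᵇ-true j≡1 = refl
colSigns-minus ℓ j (inj₂ j≡ℓ) rewrite ≡ᵇ-true j≡ℓ | ∨-zeroʳ (toℕ j ≡ᵇ 1) = refl

-- A standard-form array with the k = K + 1 full diagonals 0 … K (0-based) and
-- the extra cell (0, L), in diagonal coordinates: cell d c is the cell of
-- diagonal d in column c, i.e. at row c + d.  Along a row or a column the
-- diagonals K + 1, …, n - 1 form an empty gap of length T - 1, T = n - K,
-- interrupted only by the extra cell.
module StandardArray (n K T L : ℕ) {{_ : NonZero n}} (A : Array n)
  (filled-iff : ∀ r c → (A r c ≡ true) ⇔ (diagIdx r c < suc K ⊎ (toℕ r ≡ 0 × toℕ c ≡ L)))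
  (T+K≡n : T + K ≡ n) (L<T : L < T) (1≤K : 1 ≤ K) (2≤L : 2 ≤ L) where

  open Congruence n

  cell : ℕ → ℕ → Cell n
  cell d c = (c + d) mod n , c mod n

  extra : Cell n
  extra = 0 mod n , L mod n

  cell-≋ : ∀ d {c c′} → c ≋ c′ → cell d c ≡ cell d c′
  cell-≋ d c≋c′ = cong₂ _,_ (≋⇒mod-≡ (+-≋ˡ d c≋c′)) (≋⇒mod-≡ c≋c′)

  1≤L : 1 ≤ L
  1≤L = <⇒≤ 2≤L

  T≤n : T ≤ n
  T≤n = subst (T ≤_) T+K≡n (m≤m+n T K)

  T<n : T < n
  T<n = subst (T <_) T+K≡n (subst (_≤ T + K) (+-comm T 1) (+-monoʳ-≤ T 1≤K))

  K<n : K < n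
  K<n = subst (K <_) T+K≡n (m<n+m K (≤-<-trans z≤n L<T))

  L<n : L < n
  L<n = <-trans L<T T<n

  1≤n : 1 ≤ n
  1≤n = >-nonZero⁻¹ n

  -- The gap between the extra cell and diagonal K along row 0 / column L.
  U : ℕ
  U = T ∸ L

  L+U≡T : L + U ≡ T
  L+U≡T = m+[n∸m]≡n (<⇒≤ L<T)

  1≤U : 1 ≤ U
  1≤U = m<n⇒0<n∸m L<T

  U≤n : U ≤ n
  U≤n = ≤-trans (m∸n≤m T L) T≤n

  L+K+U≋0 : L + K + U ≋ 0
  L+K+U≋0 = trans (≡⇒≋ (trans (+-rightComm L K U) (trans (cong (_+ K) L+U≡T) T+K≡n))) (+n-≋ 0)

  in-gap : ∀ {s} → s < T → K < n ∸ s
  in-gap {s} s<T = m+n≤o⇒m≤o∸n (suc K) (subst (_≤ n) (cong suc (+-comm s K))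
                     (subst (s + K <_) T+K≡n (+-monoˡ-< K s<T)))

  n∸s<n : ∀ {s} → 1 ≤ s → s ≤ n → n ∸ s < n
  n∸s<n {suc s} _ s≤n = ∸-monoʳ-< {n} {suc s} {0} (s≤s z≤n) s≤n

  around : ∀ c s → s ≤ n → c + s + (n ∸ s) ≋ c
  around c s s≤n = trans (≡⇒≋ (trans (+-assoc c s (n ∸ s)) (cong (c +_) (m+[n∸m]≡n s≤n)))) (+n-≋ c)

  filled-on : ∀ r c D → diagIdx r c ≡ D → D ≤ K → A r c ≡ true
  filled-on r c D diag≡D D≤K = Equivalence.from (filled-iff r c) (inj₁ (s≤s (subst (_≤ K) (sym diag≡D) D≤K)))

  filled-extra : ∀ r c → toℕ r ≡ 0 → toℕ c ≡ L → A r c ≡ true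
  filled-extra r c r≡0 c≡L = Equivalence.from (filled-iff r c) (inj₂ (r≡0 , c≡L))

  empty-on : ∀ r c D → diagIdx r c ≡ D → K < D → ¬ (toℕ r ≡ 0 × toℕ c ≡ L) → A r c ≡ false
  empty-on r c D diag≡D K<D not-extra with A r c in eq
  ... | false = refl
  ... | true with Equivalence.to (filled-iff r c) eq
  ...   | inj₁ diag≤K = ⊥-elim (<⇒≱ K<D (subst (_≤ K) diag≡D (s≤s⁻¹ diag≤K)))
  ...   | inj₂ is-extra = ⊥-elim (not-extra is-extra)

  filled-cell : ∀ x → Filled A x → x ≡ extra ⊎ ∃ λ d → d ≤ K × ∃ λ c → c < n × x ≡ cell d c
  filled-cell (r , c) filled with Equivalence.to (filled-iff r c) filled
  ... | inj₂ (r≡0 , c≡L) = inj₁ (cong₂ _,_ (toℕ-injective (trans r≡0 (sym (toℕ-mod-< 1≤n))))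
                                          (toℕ-injective (trans c≡L (sym (toℕ-mod-< L<n)))))
  ... | inj₁ diag<k = inj₂ (d , s≤s⁻¹ diag<k , toℕ c , toℕ<n c ,
                           cong₂ _,_ (toℕ-injective (sym row≡)) (toℕ-injective (sym (toℕ-mod-< (toℕ<n c)))))
    where
    d = diagIdx r c
    X = toℕ r + n ∸ toℕ c
    c+d≋r : toℕ c + d ≋ toℕ r
    c+d≋r = trans (+-≋ʳ (toℕ c) (%-≋ X))
              (trans (≡⇒≋ (trans (+-comm (toℕ c) X) (m∸n+n≡m (≤-trans (<⇒≤ (toℕ<n c)) (m≤n+m n (toℕ r))))))
                     (+n-≋ (toℕ r)))
    row≡ : toℕ ((toℕ c + d) mod n) ≡ toℕ r
    row≡ = trans (toℕ-mod (toℕ c + d)) (trans c+d≋r (m<n⇒m%n≡m (toℕ<n r)))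

  fwd-≋ : ∀ c s → toℕ (fwd (c mod n) s) ≋ c + s
  fwd-≋ c s = trans (toℕ-mod-≋ (toℕ (c mod n) + s)) (+-≋ˡ s (toℕ-mod-≋ c))

  fwd-< : ∀ c s → c + s < n → toℕ (fwd (c mod n) s) ≡ c + s
  fwd-< c s c+s<n = ≋⇒≡ (toℕ<n _) c+s<n (fwd-≋ c s)

  fwd-≡ : ∀ c s c′ → c + s ≋ c′ → fwd (c mod n) s ≡ c′ mod n
  fwd-≡ c s c′ c+s≋c′ = ≋⇒mod-≡ (trans (+-≋ˡ s (toℕ-mod-≋ c)) c+s≋c′)

  bwd-≋ : ∀ x s → s ≤ n → toℕ (bwd (x mod n) s) + s ≋ x
  bwd-≋ x s s≤n = begin
      (toℕ (bwd (x mod n) s) + s) % n      ≡⟨ +-≋ˡ s (toℕ-mod-≋ (toℕ (x mod n) + n ∸ s)) ⟩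
      (toℕ (x mod n) + n ∸ s + s) % n      ≡⟨ ≡⇒≋ (m∸n+n≡m (≤-trans s≤n (m≤n+m n _))) ⟩
      (toℕ (x mod n) + n) % n              ≡⟨ +n-≋ _ ⟩
      toℕ (x mod n) % n                    ≡⟨ toℕ-mod-≋ x ⟩
      x % n                                ∎
    where open ≡-Reasoning

  bwd-≡ : ∀ x s y → s ≤ n → y + s ≋ x → bwd (x mod n) s ≡ y mod n
  bwd-≡ x s y s≤n y+s≋x = ≋⇒mod-≡ (trans (sym (toℕ-mod-≋ _)) (≋-cancelʳ s (trans (bwd-≋ x s s≤n) (sym y+s≋x))))

  diag-right : ∀ x c s D → D < n → c + s + D ≋ x → diagIdx (x mod n) (fwd (c mod n) s) ≡ D
  diag-right x c s D D<n e = diagIdx-≋ _ _ D D<n (trans (+-≋ˡ D (fwd-≋ c s)) (trans e (sym (toℕ-mod-≋ x))))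

  diag-below : ∀ x c s D → D < n → c + D ≋ x + s → diagIdx (fwd (x mod n) s) (c mod n) ≡ D
  diag-below x c s D D<n e = diagIdx-≋ _ _ D D<n (trans (+-≋ˡ D (toℕ-mod-≋ c)) (trans e (sym (fwd-≋ x s))))

  diag-above : ∀ x c s D → D < n → s ≤ n → c + D + s ≋ x → diagIdx (bwd (x mod n) s) (c mod n) ≡ D
  diag-above x c s D D<n s≤n e = diagIdx-≋ _ _ D D<n
    (≋-cancelʳ s (trans (+-≋ˡ s (+-≋ˡ D (toℕ-mod-≋ c))) (trans e (sym (bwd-≋ x s s≤n)))))

  -- For distance 1 there are no intermediate cells to check.
  no-gap : ∀ {P : ℕ → Set} s → 1 ≤ s → s < 1 → P s
  no-gap s 1≤s s<1 = ⊥-elim (<⇒≱ s<1 1≤s)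

  c+d+1≡c+[1+d] : ∀ c d → c + d + 1 ≡ c + suc d
  c+d+1≡c+[1+d] c d = trans (+-assoc c d 1) (cong (c +_) (+-comm d 1))

  -- Inside the band of full
  -- diagonals the successor is the neighbouring cell; from the border
  -- diagonals 0 and K it crosses the gap, unless the extra cell is in the way.

  sr-inner : ∀ d c → d < K → sr A (cell (suc d) c) ≡ cell d (suc c)
  sr-inner d c d<K = trans (sr-at A _ _ 1 ≤-refl 1≤n hit no-gap)
                           (cong₂ _,_ (cong (_mod n) (+-suc c d)) (fwd-≡ c 1 (suc c) (≡⇒≋ (+-comm c 1))))
    where
    hit : A ((c + suc d) mod n) (fwd (c mod n) 1) ≡ true
    hit = filled-on _ _ d (diag-right (c + suc d) c 1 d (<-trans d<K K<n) (≡⇒≋ (+-assoc c 1 d))) (<⇒≤ d<K)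

  sc-inner : ∀ d c → d < K → sc A (cell d c) ≡ cell (suc d) c
  sc-inner d c d<K = trans (sc-at A _ _ 1 ≤-refl 1≤n hit no-gap)
                           (cong (_, c mod n) (fwd-≡ (c + d) 1 (c + suc d) (≡⇒≋ (c+d+1≡c+[1+d] c d))))
    where
    hit : A (fwd ((c + d) mod n) 1) (c mod n) ≡ true
    hit = filled-on _ _ (suc d) (diag-below (c + d) c 1 (suc d) (≤-<-trans d<K K<n)
                                  (≡⇒≋ (sym (c+d+1≡c+[1+d] c d)))) d<K

  scInv-inner : ∀ d c → d < K → scInv A (cell (suc d) c) ≡ cell d c
  scInv-inner d c d<K = trans (scInv-at A _ _ 1 ≤-refl 1≤n hit no-gap)
                              (cong (_, c mod n) (bwd-≡ (c + suc d) 1 (c + d) 1≤n (≡⇒≋ (c+d+1≡c+[1+d] c d))))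
    where
    hit : A (bwd ((c + suc d) mod n) 1) (c mod n) ≡ true
    hit = filled-on _ _ d (diag-above (c + suc d) c 1 d (<-trans d<K K<n) 1≤n
                            (≡⇒≋ (c+d+1≡c+[1+d] c d))) (<⇒≤ d<K)

  sr-jump : ∀ c → c < n → c ≢ 0 → sr A (cell 0 c) ≡ cell K (c + T)
  sr-jump c c<n c≢0 = trans (sr-at A _ _ T (≤-trans 1≤L (<⇒≤ L<T)) T≤n hit miss)
      (cong₂ _,_ (≋⇒mod-≡ (trans (≡⇒≋ (+-identityʳ c)) (sym c+T+K≋c))) (fwd-≡ c T (c + T) refl))
    where
    row≡c : toℕ ((c + 0) mod n) ≡ c
    row≡c = trans (toℕ-mod-< (subst (_< n) (sym (+-identityʳ c)) c<n)) (+-identityʳ c)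
    c+T+K≋c : c + T + K ≋ c
    c+T+K≋c = trans (≡⇒≋ (trans (+-assoc c T K) (cong (c +_) T+K≡n))) (+n-≋ c)
    hit : A ((c + 0) mod n) (fwd (c mod n) T) ≡ true
    hit = filled-on _ _ K (diag-right (c + 0) c T K K<n (trans c+T+K≋c (≡⇒≋ (sym (+-identityʳ c))))) ≤-refl
    miss : ∀ s → 1 ≤ s → s < T → A ((c + 0) mod n) (fwd (c mod n) s) ≡ false
    miss s 1≤s s<T = empty-on _ _ (n ∸ s)
      (diag-right (c + 0) c s (n ∸ s) (n∸s<n 1≤s s≤n) (trans (around c s s≤n) (≡⇒≋ (sym (+-identityʳ c)))))
      (in-gap s<T) (λ (row≡0 , _) → c≢0 (trans (sym row≡c) row≡0))
      where s≤n = <⇒≤ (<-≤-trans s<T T≤n)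

  -- In row 0 the extra cell interrupts the gap.
  sr-corner : sr A (cell 0 0) ≡ extra
  sr-corner = trans (sr-at A _ _ L 1≤L (<⇒≤ L<n) hit miss) (cong (0 mod n ,_) (fwd-≡ 0 L L refl))
    where
    hit : A (0 mod n) (fwd (0 mod n) L) ≡ true
    hit = filled-extra _ _ (toℕ-mod-< 1≤n) (fwd-< 0 L L<n)
    miss : ∀ s → 1 ≤ s → s < L → A (0 mod n) (fwd (0 mod n) s) ≡ false
    miss s 1≤s s<L = empty-on _ _ (n ∸ s) (diag-right 0 0 s (n ∸ s) (n∸s<n 1≤s s≤n) (around 0 s s≤n))
      (in-gap (<-trans s<L L<T)) (λ (_ , col≡L) → <⇒≢ s<L (trans (sym (fwd-< 0 s s<n)) col≡L))
      where s<n = <-trans s<L L<n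
            s≤n = <⇒≤ s<n

  sr-extra : sr A extra ≡ cell K T
  sr-extra = trans (sr-at A _ _ U 1≤U U≤n hit miss)
      (cong₂ _,_ (≋⇒mod-≡ (sym (trans (≡⇒≋ T+K≡n) (+n-≋ 0)))) (fwd-≡ L U T (≡⇒≋ L+U≡T)))
    where
    hit : A (0 mod n) (fwd (L mod n) U) ≡ true
    hit = filled-on _ _ K (diag-right 0 L U K K<n (trans (≡⇒≋ (+-rightComm L U K)) L+K+U≋0)) ≤-refl
    miss : ∀ s → 1 ≤ s → s < U → A (0 mod n) (fwd (L mod n) s) ≡ false
    miss s 1≤s s<U = empty-on _ _ (n ∸ (L + s))
      (diag-right 0 L s (n ∸ (L + s)) (n∸s<n (≤-trans 1≤s (m≤n+m s L)) L+s≤n)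
        (trans (≡⇒≋ (m+[n∸m]≡n L+s≤n)) (+n-≋ 0)))
      (in-gap L+s<T)
      (λ (_ , col≡L) → <⇒≢ 1≤s (sym (+-cancelˡ-≡ L s 0 (trans (sym (fwd-< L s L+s<n)) (trans col≡L (sym (+-identityʳ L)))))))
      where L+s<T = subst (L + s <_) L+U≡T (+-monoʳ-< L s<U)
            L+s<n = <-trans L+s<T T<n
            L+s≤n = <⇒≤ L+s<n

  sc-wrap : ∀ c → c < n → c ≢ L → sc A (cell K c) ≡ cell 0 c
  sc-wrap c c<n c≢L = trans (sc-at A _ _ T (≤-trans 1≤L (<⇒≤ L<T)) T≤n hit miss)
      (cong (_, c mod n) (fwd-≡ (c + K) T (c + 0) (trans c+K+T≋c (≡⇒≋ (sym (+-identityʳ c))))))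
    where
    c+K+T≋c : c + K + T ≋ c
    c+K+T≋c = trans (≡⇒≋ (trans (+-assoc c K T) (cong (c +_) (trans (+-comm K T) T+K≡n)))) (+n-≋ c)
    hit : A (fwd ((c + K) mod n) T) (c mod n) ≡ true
    hit = filled-on _ _ 0 (diag-below (c + K) c T 0 1≤n (trans (≡⇒≋ (+-identityʳ c)) (sym c+K+T≋c))) z≤n
    miss : ∀ s → 1 ≤ s → s < T → A (fwd ((c + K) mod n) s) (c mod n) ≡ false
    miss s 1≤s s<T = empty-on _ _ (K + s)
      (diag-below (c + K) c s (K + s) (subst (_< n) (+-comm s K) (subst (s + K <_) T+K≡n (+-monoˡ-< K s<T)))
        (≡⇒≋ (sym (+-assoc c K s))))
      (subst (_≤ K + s) (+-comm K 1) (+-monoʳ-≤ K 1≤s))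
      (λ (_ , col≡L) → c≢L (trans (sym (toℕ-mod-< c<n)) col≡L))

  scInv-wrap : ∀ c → c < n → c ≢ L → scInv A (cell 0 c) ≡ cell K c
  scInv-wrap c c<n c≢L = trans (scInv-at A _ _ T (≤-trans 1≤L (<⇒≤ L<T)) T≤n hit miss)
      (cong (_, c mod n) (bwd-≡ (c + 0) T (c + K) T≤n (trans c+K+T≋c (≡⇒≋ (sym (+-identityʳ c))))))
    where
    c+K+T≋c : c + K + T ≋ c
    c+K+T≋c = trans (≡⇒≋ (trans (+-assoc c K T) (cong (c +_) (trans (+-comm K T) T+K≡n)))) (+n-≋ c)
    hit : A (bwd ((c + 0) mod n) T) (c mod n) ≡ true
    hit = filled-on _ _ K (diag-above (c + 0) c T K K<n T≤n (trans c+K+T≋c (≡⇒≋ (sym (+-identityʳ c))))) ≤-refl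
    miss : ∀ s → 1 ≤ s → s < T → A (bwd ((c + 0) mod n) s) (c mod n) ≡ false
    miss s 1≤s s<T = empty-on _ _ (n ∸ s)
      (diag-above (c + 0) c s (n ∸ s) (n∸s<n 1≤s s≤n) s≤n
        (trans (≡⇒≋ (+-rightComm c (n ∸ s) s)) (trans (around c s s≤n) (≡⇒≋ (sym (+-identityʳ c))))))
      (in-gap s<T) (λ (_ , col≡L) → c≢L (trans (sym (toℕ-mod-< c<n)) col≡L))
      where s≤n = <⇒≤ (<-≤-trans s<T T≤n)

  -- In column L the extra cell interrupts the gap.
  scInv-below-extra : scInv A (cell 0 L) ≡ extra
  scInv-below-extra = trans (scInv-at A _ _ L 1≤L L≤n hit miss)
      (cong (_, L mod n) (bwd-≡ (L + 0) L 0 L≤n (≡⇒≋ (sym (+-identityʳ L)))))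
    where
    L≤n = <⇒≤ L<n
    row-at : ∀ s → s ≤ n → toℕ (bwd ((L + 0) mod n) s) + s ≋ L
    row-at s s≤n = trans (bwd-≋ (L + 0) s s≤n) (≡⇒≋ (+-identityʳ L))
    hit : A (bwd ((L + 0) mod n) L) (L mod n) ≡ true
    hit = filled-extra _ _ (≋⇒≡ (toℕ<n _) 1≤n (≋-cancelʳ L (row-at L L≤n))) (toℕ-mod-< L<n)
    miss : ∀ s → 1 ≤ s → s < L → A (bwd ((L + 0) mod n) s) (L mod n) ≡ false
    miss s 1≤s s<L = empty-on _ _ (n ∸ s)
      (diag-above (L + 0) L s (n ∸ s) (n∸s<n 1≤s s≤n) s≤n
        (trans (≡⇒≋ (+-rightComm L (n ∸ s) s)) (trans (around L s s≤n) (≡⇒≋ (sym (+-identityʳ L))))))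
      (in-gap (<-trans s<L L<T))
      (λ (row≡0 , _) → <⇒≢ s<L (≋⇒≡ s<n L<n (subst (λ r → r + s ≋ L) row≡0 (row-at s s≤n))))
      where s<n = <-trans s<L L<n
            s≤n = <⇒≤ s<n

  scInv-extra : scInv A extra ≡ cell K L
  scInv-extra = trans (scInv-at A _ _ U 1≤U U≤n hit miss)
      (cong (_, L mod n) (bwd-≡ 0 U (L + K) U≤n L+K+U≋0))
    where
    hit : A (bwd (0 mod n) U) (L mod n) ≡ true
    hit = filled-on _ _ K (diag-above 0 L U K K<n U≤n L+K+U≋0) ≤-refl
    miss : ∀ s → 1 ≤ s → s < U → A (bwd (0 mod n) s) (L mod n) ≡ false
    miss s 1≤s s<U = empty-on _ _ (n ∸ (L + s))
      (diag-above 0 L s (n ∸ (L + s)) (n∸s<n (≤-trans 1≤s (m≤n+m s L)) L+s≤n) s≤n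
        (trans (≡⇒≋ (trans (+-rightComm L (n ∸ (L + s)) s) (m+[n∸m]≡n L+s≤n))) (+n-≋ 0)))
      (in-gap L+s<T)
      (λ (row≡0 , _) → <⇒≢ 1≤s (sym (≋⇒≡ s<n 1≤n (subst (λ r → r + s ≋ 0) row≡0 (bwd-≋ 0 s s≤n)))))
      where L+s<T = subst (L + s <_) L+U≡T (+-monoʳ-< L s<U)
            L+s≤n = <⇒≤ (<-trans L+s<T T<n)
            s<n = ≤-<-trans (m≤n+m s L) (<-trans L+s<T T<n)
            s≤n = <⇒≤ s<n

  C : Fin n → Sign
  C = colSigns (suc L)

  S : Cell n → Cell n
  S = move A allPlus C

  move-via : ∀ x {y z} σ → sr A x ≡ y → C (proj₂ y) ≡ σ → colPow A σ y ≡ z → S x ≡ z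
  move-via (i , j) σ refl sign col = trans (cong (λ τ → colPow A τ _) sign) col

  column-minus : ∀ c → c % n ≡ 1 ⊎ c % n ≡ L → C (c mod n) ≡ ⊖
  column-minus c at-minus = colSigns-minus (suc L) (c mod n) (⊎-map (trans (toℕ-mod c)) (trans (toℕ-mod c)) at-minus)

  column-plus : ∀ c → c % n ≢ 1 → c % n ≢ L → C (c mod n) ≡ ⊕
  column-plus c c≢1 c≢L = colSigns-plus (suc L) (c mod n) (λ e → c≢1 (trans (sym (toℕ-mod c)) e))
                                                          (λ e → c≢L (trans (sym (toℕ-mod c)) e))

  instance
    K-nonZero : NonZero K
    K-nonZero = >-nonZero 1≤K

  move-along : ∀ d c → d < K → suc c % n ≢ 1 → suc c % n ≢ L → S (cell (suc d) c) ≡ cell (suc d) (suc c)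
  move-along d c d<K c≢1 c≢L =
    move-via (cell (suc d) c) ⊕ (sr-inner d c d<K) (column-plus (suc c) c≢1 c≢L) (sc-inner d (suc c) d<K)

  move-descend : ∀ d c → suc d < K → suc c % n ≡ 1 ⊎ suc c % n ≡ L →
                 S (cell (suc (suc d)) c) ≡ cell d (suc c)
  move-descend d c d+1<K at-minus = move-via (cell (suc (suc d)) c) ⊖ (sr-inner (suc d) c d+1<K)
    (column-minus (suc c) at-minus) (scInv-inner d (suc c) (<-trans (n<1+n d) d+1<K))

  -- From diagonal 1 the descent lands on diagonal 0 and continues upwards:
  -- across the gap to diagonal K in column 1, onto the extra cell in column L.
  move-wrap : ∀ c → suc c % n ≡ 1 → S (cell 1 c) ≡ cell K (suc c)
  move-wrap c c≡1 = move-via (cell 1 c) ⊖ (sr-inner 0 c 1≤K) (column-minus (suc c) (inj₁ c≡1)) (begin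
      scInv A (cell 0 (suc c))        ≡⟨ cong (scInv A) (cell-≋ 0 (sym (%-≋ (suc c)))) ⟩
      scInv A (cell 0 (suc c % n))    ≡⟨ scInv-wrap (suc c % n) (m%n<n (suc c) n) (λ c≡L → <⇒≢ 2≤L (trans (sym c≡1) c≡L)) ⟩
      cell K (suc c % n)              ≡⟨ cell-≋ K (%-≋ (suc c)) ⟩
      cell K (suc c)                  ∎)
    where open ≡-Reasoning

  move-to-extra : ∀ c → suc c % n ≡ L → S (cell 1 c) ≡ extra
  move-to-extra c c≡L = move-via (cell 1 c) ⊖ (sr-inner 0 c 1≤K) (column-minus (suc c) (inj₂ c≡L))
    (trans (cong (scInv A) (trans (cell-≋ 0 (sym (%-≋ (suc c)))) (cong (cell 0) c≡L))) scInv-below-extra)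

  move-jump : ∀ c → c < n → c ≢ 0 → (c + T) % n ≢ 1 → (c + T) % n ≢ L → S (cell 0 c) ≡ cell 0 (c + T)
  move-jump c c<n c≢0 c+T≢1 c+T≢L = move-via (cell 0 c) ⊕ (sr-jump c c<n c≢0) (column-plus (c + T) c+T≢1 c+T≢L) (begin
      sc A (cell K (c + T))           ≡⟨ cong (sc A) (cell-≋ K (sym (%-≋ (c + T)))) ⟩
      sc A (cell K ((c + T) % n))     ≡⟨ sc-wrap ((c + T) % n) (m%n<n (c + T) n) c+T≢L ⟩
      cell 0 ((c + T) % n)            ≡⟨ cell-≋ 0 (%-≋ (c + T)) ⟩
      cell 0 (c + T)                  ∎)
    where open ≡-Reasoning

  move-exit : ∀ c → c < n → c ≢ 0 → (c + T) % n ≡ 1 ⊎ (c + T) % n ≡ L → S (cell 0 c) ≡ cell (pred K) (c + T)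
  move-exit c c<n c≢0 at-minus = move-via (cell 0 c) ⊖ (sr-jump c c<n c≢0) (column-minus (c + T) at-minus)
    (trans (cong (λ d → scInv A (cell d (c + T))) (sym (suc-pred K))) (scInv-inner (pred K) (c + T) (subst (pred K <_) (suc-pred K) (n<1+n (pred K)))))

  move-corner : S (cell 0 0) ≡ cell K L
  move-corner = move-via (cell 0 0) ⊖ sr-corner (column-minus L (inj₂ (m<n⇒m%n≡m L<n))) scInv-extra

  move-extra : S extra ≡ cell 0 T
  move-extra = move-via extra ⊕ sr-extra (column-plus T T≢1 T≢L) (sc-wrap T T<n (λ T≡L → <⇒≢ L<T (sym T≡L)))
    where
    T%n≡T = m<n⇒m%n≡m T<n
    T≢1 : T % n ≢ 1
    T≢1 T≡1 = <⇒≱ (<-≤-trans L<T (≤-reflexive (trans (sym T%n≡T) T≡1))) 1≤L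
    T≢L : T % n ≢ L
    T≢L T≡L = <⇒≢ L<T (sym (trans (sym T%n≡T) T≡L))

module Reachability {X : Set} (f : X → X) where

  Reach : X → X → Set
  Reach x y = ∃ λ m → iter f m x ≡ y

  iter-+ : ∀ a b x → iter f (a + b) x ≡ iter f a (iter f b x)
  iter-+ zero b x = refl
  iter-+ (suc a) b x = cong f (iter-+ a b x)

  reach-≡ : ∀ {x y} → x ≡ y → Reach x y
  reach-≡ x≡y = 0 , x≡y

  reach-step : ∀ {x y} → f x ≡ y → Reach x y
  reach-step fx≡y = 1 , fx≡y

  infixr 5 _⟫_
  _⟫_ : ∀ {x y z} → Reach x y → Reach y z → Reach x z
  _⟫_ {x} (a , fᵃx≡y) (b , fᵇy≡z) = b + a , trans (iter-+ b a x) (trans (cong (iter f b) fᵃx≡y) fᵇy≡z)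

module Tour (n K T L : ℕ) {{_ : NonZero n}} (A : Array n)
  (filled-iff : ∀ r c → (A r c ≡ true) ⇔ (diagIdx r c < suc K ⊎ (toℕ r ≡ 0 × toℕ c ≡ L)))
  (T+K≡n : T + K ≡ n) (L<T : L < T) (2≤L : 2 ≤ L)
  (K≡2[4] : K % 4 ≡ 2) (L-even : L % 2 ≡ 0) (gcd≡2 : gcd n T ≡ 2) where

  -- K ≡ 2 (mod 4) gives K ≥ 2, so there are at least three diagonals.
  2≤K : 2 ≤ K
  2≤K = subst (_≤ K) K≡2[4] (m%n≤m K 4)

  open Congruence n
  open StandardArray n K T L A filled-iff T+K≡n L<T (<⇒≤ 2≤K) 2≤L
  open Reachability S
  open TranslationOrbit n T gcd≡2

  1<n : 1 < n
  1<n = <-trans 2≤L L<n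

  -- Columns of sign +1: arriving there, a move on a diagonal d ≥ 1 just advances.
  Open : ℕ → Set
  Open c = c % n ≢ 1 × c % n ≢ L

  -- Every column 2 … n other than L is open (column n ≡ 0 included).
  open-column : ∀ c → 2 ≤ c → c ≤ n → c ≢ L → Open c
  open-column c 2≤c c≤n c≢L with m≤n⇒m<n∨m≡n c≤n
  ... | inj₁ c<n = (λ c≡1 → <⇒≢ 2≤c (sym (trans (sym (m<n⇒m%n≡m c<n)) c≡1)))
                 , (λ c≡L → c≢L (trans (sym (m<n⇒m%n≡m c<n)) c≡L))
  ... | inj₂ refl = (λ n≡1 → 0≢1+n (trans (sym (n%n≡0 n)) n≡1))
                  , (λ n≡L → <⇒≢ 1≤L (trans (sym (n%n≡0 n)) n≡L))

  sweep : ∀ d a u → d < K → (∀ c → a < c → c ≤ a + u → Open c) →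
          Reach (cell (suc d) a) (cell (suc d) (a + u))
  sweep d a zero d<K all-open = reach-≡ (cong (cell (suc d)) (sym (+-identityʳ a)))
  sweep d a (suc u) d<K all-open =
    sweep d a u d<K (λ c a<c c≤a+u → all-open c a<c (≤-trans c≤a+u (+-monoʳ-≤ a (n≤1+n u))))
    ⟫ reach-step (move-along d (a + u) d<K (proj₁ next-open) (proj₂ next-open))
    ⟫ reach-≡ (cong (cell (suc d)) (sym (+-suc a u)))
    where next-open = all-open (suc (a + u)) (s≤s (m≤m+n a u)) (≤-reflexive (sym (+-suc a u)))

  -- Each diagonal d ≥ 1 splits into two segments of open columns: the
  -- left one, columns 1 … L - 1, and the right one, columns L … n (≡ 0).
  data Side : Set where
    left right : Side

  other : Side → Side
  other left = right
  other right = left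

  other-other : ∀ s → other (other s) ≡ s
  other-other left = refl
  other-other right = refl

  first : Side → ℕ
  first left = 1
  first right = L

  len : Side → ℕ
  len left = L ∸ 2
  len right = n ∸ L

  start : Side → ℕ → Cell n
  start s d = cell d (first s)

  finish : Side → ℕ → Cell n
  finish s d = cell d (first s + len s)

  segment-open : ∀ s c → first s < c → c ≤ first s + len s → Open c
  segment-open left c 1<c c≤ = open-column c 1<c (<⇒≤ (<-trans c<L L<n)) (<⇒≢ c<L)
    where c<L = ≤-trans (s≤s c≤) (≤-reflexive (m+[n∸m]≡n 2≤L))
  segment-open right c L<c c≤ = open-column c (<⇒≤ (≤-<-trans 2≤L L<c))
    (≤-trans c≤ (≤-reflexive (m+[n∸m]≡n (<⇒≤ L<n)))) (λ c≡L → <⇒≢ L<c (sym c≡L))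

  -- The column after a segment is the (sign −1) first column of the other one.
  after-segment : ∀ s → suc (first s + len s) % n ≡ first (other s)
  after-segment left = trans (cong (_% n) (m+[n∸m]≡n 2≤L)) (m<n⇒m%n≡m L<n)
  after-segment right = trans (cong (λ m → suc m % n) (m+[n∸m]≡n (<⇒≤ L<n)))
                              (trans ([m+n]%n≡m%n 1 n) (m<n⇒m%n≡m 1<n))

  first-minus : ∀ s → first s ≡ 1 ⊎ first s ≡ L
  first-minus left = inj₁ refl
  first-minus right = inj₂ refl

  walk : ∀ s d → d < K → Reach (start s (suc d)) (finish s (suc d))
  walk s d d<K = sweep d (first s) (len s) d<K (segment-open s)

  within : ∀ s d v → d < K → v ≤ len s →
           Reach (start s (suc d)) (cell (suc d) (first s + v)) × Reach (cell (suc d) (first s + v)) (finish s (suc d))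
  within s d v d<K v≤len =
    sweep d (first s) v d<K (λ c a<c c≤ → segment-open s c a<c (≤-trans c≤ (+-monoʳ-≤ (first s) v≤len))) ,
    (sweep d (first s + v) (len s ∸ v) d<K
       (λ c a<c c≤ → segment-open s c (≤-<-trans (m≤m+n (first s) v) a<c) (≤-trans c≤ (≤-reflexive to-end)))
     ⟫ reach-≡ (cong (cell (suc d)) to-end))
    where to-end : first s + v + (len s ∸ v) ≡ first s + len s
          to-end = trans (+-assoc (first s) v _) (cong (first s +_) (m+[n∸m]≡n v≤len))

  turn : ∀ s d → suc d < K → Reach (finish s (suc (suc d))) (start (other s) d)
  turn s d d+1<K = reach-step (move-descend d (first s + len s) d+1<K
                                 (subst (λ c → c ≡ 1 ⊎ c ≡ L) (sym (after-segment s)) (first-minus (other s))))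
                   ⟫ reach-≡ (cell-≋ d (trans (after-segment s) (sym (m<n⇒m%n≡m first<n))))
    where first<n : first (other s) < n
          first<n with other s
          ... | left = 1<n
          ... | right = L<n

  lap : ∀ s d → suc d < K → Reach (start s (suc (suc d))) (start (other s) d)
  lap s d d+1<K = walk s (suc d) d+1<K ⟫ turn s d d+1<K

  descend : ∀ m s d → 4 * m + d ≤ K → Reach (start s (4 * m + d)) (start s d)
  descend zero s d _ = reach-≡ refl
  descend (suc m) s d bound =
    reach-≡ (cong (λ x → start s (x + d)) (*-suc 4 m))
    ⟫ lap s (suc (suc D)) bound′
    ⟫ lap (other s) D (<-trans (n<1+n (suc D)) (<-trans (n<1+n (suc (suc D))) bound′))
    ⟫ reach-≡ (cong (λ σ → start σ D) (other-other s))
    ⟫ descend m s d (≤-trans (m≤n+m D 3) (<⇒≤ bound′))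
    where
    D = 4 * m + d
    bound′ : suc (suc (suc D)) < K
    bound′ = subst (_≤ K) (cong (_+ d) (*-suc 4 m)) bound

  exit-left : Reach (finish left 1) extra
  exit-left = reach-step (move-to-extra (1 + len left) (after-segment left))

  exit-right : Reach (finish right 1) (start left K)
  exit-right = reach-step (trans (move-wrap (L + len right) (after-segment right)) (cell-≋ K (trans (after-segment right) (sym (m<n⇒m%n≡m 1<n)))))

  -- On diagonal 0 the orbit of S follows the translation orbit c ↦ c + T,
  -- as long as each jump is a plain one.
  Plain : ℕ → ℕ → Set
  Plain b t = orbit b t ≢ 0 × orbit b (suc t) ≢ 1 × orbit b (suc t) ≢ L

  jump : ∀ b t → Plain b t → Reach (cell 0 (orbit b t)) (cell 0 (orbit b (suc t)))
  jump b t (≢0 , ≢1 , ≢L) = reach-step (trans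
    (move-jump (orbit b t) (orbit-< b t) ≢0 (λ e → ≢1 (trans (sym (orbit-suc b t)) e)) (λ e → ≢L (trans (sym (orbit-suc b t)) e)))
    (cell-≋ 0 (orbit-suc-≋ b t)))

  jump-exit : ∀ b t → orbit b t ≢ 0 → orbit b (suc t) ≡ 1 ⊎ orbit b (suc t) ≡ L →
              Reach (cell 0 (orbit b t)) (cell (pred K) (orbit b (suc t)))
  jump-exit b t ≢0 at-minus = reach-step (trans
    (move-exit (orbit b t) (orbit-< b t) ≢0 (subst (λ c → c ≡ 1 ⊎ c ≡ L) (sym (orbit-suc b t)) at-minus))
    (cell-≋ (pred K) (orbit-suc-≋ b t)))

  chain : ∀ b t u → (∀ v → v < u → Plain b (t + v)) → Reach (cell 0 (orbit b t)) (cell 0 (orbit b (t + u)))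
  chain b t zero _ = reach-≡ (cong (λ x → cell 0 (orbit b x)) (sym (+-identityʳ t)))
  chain b t (suc u) plain = chain b t u (λ v v<u → plain v (m<n⇒m<1+n v<u))
    ⟫ jump b (t + u) (plain u ≤-refl)
    ⟫ reach-≡ (cong (λ x → cell 0 (orbit b x)) (sym (+-suc t u)))

  chain-between : ∀ b t t′ → t ≤ t′ → (∀ w → t ≤ w → w < t′ → Plain b w) →
                  Reach (cell 0 (orbit b t)) (cell 0 (orbit b t′))
  chain-between b t t′ t≤t′ plain =
    chain b t (t′ ∸ t) (λ v v< → plain (t + v) (m≤m+n t v) (subst (t + v <_) (m+[n∸m]≡n t≤t′) (+-monoʳ-< t v<)))
    ⟫ reach-≡ (cong (λ x → cell 0 (orbit b x)) (m+[n∸m]≡n t≤t′))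

  last : ℕ
  last = pred half

  suc-last : suc last ≡ half
  suc-last = suc-pred half

  ≤last : ∀ {t} → t < half → t ≤ last
  ≤last t<half = s≤s⁻¹ (subst (_ <_) (sym suc-last) t<half)

  -- The odd columns form one orbit, entered and left at column 1.
  odd-chain : ∀ c → c < n → c % 2 ≡ 1 → Reach (cell 0 1) (cell 0 c) × Reach (cell 0 c) (start left (pred K))
  odd-chain c c<n c-odd with orbit-onto 1<n c<n c-odd
  ... | t , t<half , orbit≡c =
    (reach-≡ (cong (cell 0) (sym (orbit-zero 1<n))) ⟫ chain-between 1 0 t z≤n (λ w _ w<t → plain w (≤-<-trans w<t t<half))
     ⟫ reach-≡ (cong (cell 0) orbit≡c)) ,
    (reach-≡ (cong (cell 0) (sym orbit≡c)) ⟫ chain-between 1 t last (≤last t<half) (λ w _ w<last → plain w (subst (suc w <_) suc-last (s≤s w<last)))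
     ⟫ jump-exit 1 last (odd≢0 last) (inj₁ back-at-1) ⟫ reach-≡ (cong (cell (pred K)) back-at-1))
    where
    odd≢0 : ∀ t → orbit 1 t ≢ 0
    odd≢0 t e = 0≢1+n (trans (cong (_% 2) (sym e)) (orbit-parity 1 t))
    plain : ∀ w → suc w < half → Plain 1 w
    plain w w+1<half = odd≢0 w
      , (λ e → 0≢1+n (orbit-cancel 1 (≤-<-trans z≤n w+1<half) w+1<half (trans (orbit-zero 1<n) (sym e))))
      , (λ e → 0≢1+n (trans (trans (sym L-even) (cong (_% 2) (sym e))) (orbit-parity 1 (suc w))))
    back-at-1 : orbit 1 (suc last) ≡ 1
    back-at-1 = trans (cong (orbit 1) suc-last) (orbit-half 1<n)

  -- The even columns form one orbit, entered and left at column L.  It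
  -- passes column 0 once, at time z₀; there S leaves diagonal 0 through the
  -- corner (0,0) and the orbit is resumed from the extra cell.
  zero-visit : ∃ λ t → t < half × orbit L t ≡ 0
  zero-visit = orbit-onto L<n 1≤n (sym L-even)

  z₀ : ℕ
  z₀ = proj₁ zero-visit

  z₀<half : z₀ < half
  z₀<half = proj₁ (proj₂ zero-visit)

  orbit-z₀ : orbit L z₀ ≡ 0
  orbit-z₀ = proj₂ (proj₂ zero-visit)

  orbit-after-z₀ : orbit L (suc z₀) ≡ T
  orbit-after-z₀ = trans (sym (orbit-suc L z₀)) (trans (cong (λ x → (x + T) % n) orbit-z₀) (m<n⇒m%n≡m T<n))

  back-at-L : orbit L (suc last) ≡ L
  back-at-L = trans (cong (orbit L) suc-last) (orbit-half L<n)

  z₀<last : z₀ < last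
  z₀<last with m≤n⇒m<n∨m≡n (≤last z₀<half)
  ... | inj₁ z₀<last = z₀<last
  ... | inj₂ z₀≡last = ⊥-elim (<⇒≢ L<T (trans (sym back-at-L) (trans (cong (λ x → orbit L (suc x)) (sym z₀≡last)) orbit-after-z₀)))

  even-plain : ∀ w → w ≢ z₀ → suc w < half → Plain L w
  even-plain w w≢z₀ w+1<half =
    (λ e → w≢z₀ (orbit-cancel L (<-trans (n<1+n w) w+1<half) z₀<half (trans e (sym orbit-z₀)))) ,
    (λ e → 0≢1+n (trans (sym L-even) (trans (sym (orbit-parity L (suc w))) (cong (_% 2) e)))) ,
    (λ e → 0≢1+n (sym (orbit-cancel L w+1<half (≤-<-trans z≤n w+1<half) (trans e (sym (orbit-zero L<n))))))

  even-before : ∀ t → t ≤ z₀ → Reach (cell 0 L) (cell 0 (orbit L t)) × Reach (cell 0 (orbit L t)) (start right K)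
  even-before t t≤z₀ =
    (reach-≡ (cong (cell 0) (sym (orbit-zero L<n))) ⟫ chain-between L 0 t z≤n (λ w _ w<t → plain w (<-≤-trans w<t t≤z₀))) ,
    (chain-between L t z₀ t≤z₀ (λ w _ w<z₀ → plain w w<z₀) ⟫ reach-≡ (cong (cell 0) orbit-z₀) ⟫ reach-step move-corner)
    where plain : ∀ w → w < z₀ → Plain L w
          plain w w<z₀ = even-plain w (<⇒≢ w<z₀) (≤-<-trans w<z₀ z₀<half)

  even-after : ∀ t → z₀ < t → t < half → Reach extra (cell 0 (orbit L t)) × Reach (cell 0 (orbit L t)) (start right (pred K))
  even-after t z₀<t t<half =
    (reach-step move-extra ⟫ reach-≡ (cong (cell 0) (sym orbit-after-z₀))
      ⟫ chain-between L (suc z₀) t z₀<t (λ w z₀<w w<t → plain w z₀<w (≤-<-trans w<t t<half))) ,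
    (chain-between L t last (≤last t<half) (λ w z₀<w w<last → plain w (≤-trans z₀<t z₀<w) (subst (suc w <_) suc-last (s≤s w<last)))
      ⟫ jump-exit L last (λ e → <⇒≢ z₀<last (orbit-cancel L z₀<half (subst (last <_) suc-last (n<1+n last)) (trans orbit-z₀ (sym e))))
                         (inj₂ back-at-L)
      ⟫ reach-≡ (cong (cell (pred K)) back-at-L))
    where plain : ∀ w → z₀ < w → suc w < half → Plain L w
          plain w z₀<w w+1<half = even-plain w (λ w≡z₀ → <⇒≢ z₀<w (sym w≡z₀)) w+1<half

  -- Since K = 4q + 2, the laps from the left segment of
  -- diagonal K reach the left segment of diagonal 2, and similarly for the
  -- right side and for diagonal K - 1 = 4q + 1 down to diagonal 1.  The
  -- orbit of S then runs
  --   hub = start of left K ⇝ (cell 0 L) ⇝ start of right K ⇝ (cell 0 1)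
  --       ⇝ start of left (K-1) ⇝ extra ⇝ start of right (K-1) ⇝ hub.
  q : ℕ
  q = K / 4

  K≡4q+2 : K ≡ 4 * q + 2
  K≡4q+2 = trans (m≡m%n+[m/n]*n K 4) (trans (cong (_+ q * 4) K≡2[4]) (trans (+-comm 2 (q * 4)) (cong (_+ 2) (*-comm q 4))))

  K-1≡4q+1 : pred K ≡ 4 * q + 1
  K-1≡4q+1 = cong pred (trans K≡4q+2 (+-suc (4 * q) 1))

  down-to-2 : ∀ s → Reach (start s K) (start s 2)
  down-to-2 s = reach-≡ (cong (start s) K≡4q+2) ⟫ descend q s 2 (≤-reflexive (sym K≡4q+2))

  down-to-1 : ∀ s → Reach (start s (pred K)) (start s 1)
  down-to-1 s = reach-≡ (cong (start s) K-1≡4q+1) ⟫ descend q s 1 (≤-trans (≤-reflexive (sym K-1≡4q+1)) pred[n]≤n)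

  hub : Cell n
  hub = start left K

  hub⇝right₀ : Reach hub (start right 0)
  hub⇝right₀ = down-to-2 left ⟫ lap left 0 2≤K

  right₀⇝rightK : Reach (start right 0) (start right K)
  right₀⇝rightK = proj₁ (even-before z₀ ≤-refl) ⟫ proj₂ (even-before z₀ ≤-refl)

  rightK⇝left₀ : Reach (start right K) (start left 0)
  rightK⇝left₀ = down-to-2 right ⟫ lap right 0 2≤K

  left₀⇝leftK-1 : Reach (start left 0) (start left (pred K))
  left₀⇝leftK-1 = proj₂ (odd-chain 1 1<n refl)

  leftK-1⇝extra : Reach (start left (pred K)) extra
  leftK-1⇝extra = down-to-1 left ⟫ walk left 0 (<⇒≤ 2≤K) ⟫ exit-left

  extra⇝rightK-1 : Reach extra (start right (pred K))
  extra⇝rightK-1 = proj₁ (even-after (suc z₀) ≤-refl z₀+1<half) ⟫ proj₂ (even-after (suc z₀) ≤-refl z₀+1<half)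
    where z₀+1<half = subst (suc z₀ <_) suc-last (s≤s z₀<last)

  rightK-1⇝hub : Reach (start right (pred K)) hub
  rightK-1⇝hub = down-to-1 right ⟫ walk right 0 (<⇒≤ 2≤K) ⟫ exit-right

  extra⇝hub : Reach extra hub
  extra⇝hub = extra⇝rightK-1 ⟫ rightK-1⇝hub

  left₀⇝hub : Reach (start left 0) hub
  left₀⇝hub = left₀⇝leftK-1 ⟫ leftK-1⇝extra ⟫ extra⇝hub

  right₀⇝hub : Reach (start right 0) hub
  right₀⇝hub = right₀⇝rightK ⟫ rightK⇝left₀ ⟫ left₀⇝hub

  hub⇝left₀ : Reach hub (start left 0)
  hub⇝left₀ = hub⇝right₀ ⟫ right₀⇝rightK ⟫ rightK⇝left₀

  hub⇝extra : Reach hub extra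
  hub⇝extra = hub⇝left₀ ⟫ left₀⇝leftK-1 ⟫ leftK-1⇝extra

  hub⇝start : ∀ j s D → D + j ≡ K → Reach hub (start s D)
  hub⇝start zero left D D+0≡K = reach-≡ (cong (start left) (sym (trans (sym (+-identityʳ D)) D+0≡K)))
  hub⇝start zero right D D+0≡K =
    hub⇝right₀ ⟫ right₀⇝rightK ⟫ reach-≡ (cong (start right) (sym (trans (sym (+-identityʳ D)) D+0≡K)))
  hub⇝start (suc zero) left D D+1≡K =
    hub⇝left₀ ⟫ left₀⇝leftK-1 ⟫ reach-≡ (cong (start left) (sym (cong pred (trans (+-comm 1 D) D+1≡K))))
  hub⇝start (suc zero) right D D+1≡K =
    hub⇝extra ⟫ extra⇝rightK-1 ⟫ reach-≡ (cong (start right) (sym (cong pred (trans (+-comm 1 D) D+1≡K))))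
  hub⇝start (suc (suc j)) s D D+j+2≡K =
    hub⇝start j (other s) (suc (suc D)) D+2+j≡K ⟫ lap (other s) D D+1<K ⟫ reach-≡ (cong (λ σ → start σ D) (other-other s))
    where
    D+2+j≡K : suc (suc D) + j ≡ K
    D+2+j≡K = trans (sym (trans (+-suc D (suc j)) (cong suc (+-suc D j)))) D+j+2≡K
    D+1<K : suc D < K
    D+1<K = subst (suc (suc D) ≤_) D+2+j≡K (s≤s (s≤s (m≤m+n D j)))

  finish⇝hub : ∀ s D → 1 ≤ D → D ≤ K → Reach (finish s D) hub
  finish⇝hub left 1 _ _ = exit-left ⟫ extra⇝hub
  finish⇝hub right 1 _ _ = exit-right
  finish⇝hub left 2 _ _ = turn left 0 2≤K ⟫ right₀⇝hub
  finish⇝hub right 2 _ _ = turn right 0 2≤K ⟫ left₀⇝hub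
  finish⇝hub s (suc (suc (suc d))) _ d+3≤K =
    turn s (suc d) d+3≤K ⟫ walk (other s) d d<K ⟫ finish⇝hub (other s) (suc d) (s≤s z≤n) d<K
    where d<K = <-trans (n<1+n d) (<-trans (n<1+n (suc d)) d+3≤K)

  OnTour : Cell n → Set
  OnTour x = Reach x hub × Reach hub x

  on-tour-extra : OnTour extra
  on-tour-extra = extra⇝hub , hub⇝extra

  on-tour-segment : ∀ s d v → d < K → v ≤ len s → OnTour (cell (suc d) (first s + v))
  on-tour-segment s d v d<K v≤len =
    proj₂ (within s d v d<K v≤len) ⟫ finish⇝hub s (suc d) (s≤s z≤n) d<K ,
    hub⇝start (K ∸ suc d) s (suc d) (m+[n∸m]≡n d<K) ⟫ proj₁ (within s d v d<K v≤len)

  on-tour-band : ∀ d c → d < K → c < n → OnTour (cell (suc d) c)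
  on-tour-band d zero d<K _ =
    subst OnTour (cell-≋ (suc d) (trans (≡⇒≋ (m+[n∸m]≡n (<⇒≤ L<n))) (+n-≋ 0)))
          (on-tour-segment right d (len right) d<K ≤-refl)
  on-tour-band d (suc j) d<K j<n with suc j <? L
  ... | yes j+1<L = on-tour-segment left d j d<K (m+n≤o⇒m≤o∸n j (subst (_≤ L) (+-comm 2 j) j+1<L))
  ... | no j+1≮L = subst (λ c → OnTour (cell (suc d) c)) (m+[n∸m]≡n L≤j+1)
                         (on-tour-segment right d (suc j ∸ L) d<K (∸-monoˡ-≤ L (<⇒≤ j<n)))
    where L≤j+1 = ≮⇒≥ j+1≮L

  on-tour-diagonal₀ : ∀ c → c < n → OnTour (cell 0 c)
  on-tour-diagonal₀ c c<n with c % 2 in c%2 | m%n<n c 2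
  ... | 1 | _ = proj₂ (odd-chain c c<n c%2) ⟫ leftK-1⇝extra ⟫ extra⇝hub ,
                hub⇝left₀ ⟫ proj₁ (odd-chain c c<n c%2)
  ... | 0 | _ with orbit-onto L<n c<n (trans c%2 (sym L-even))
  ...   | t , t<half , orbit≡c with t ≤? z₀
  ...     | yes t≤z₀ = subst OnTour (cong (cell 0) orbit≡c)
                         (proj₂ (even-before t t≤z₀) ⟫ rightK⇝left₀ ⟫ left₀⇝hub ,
                          hub⇝right₀ ⟫ proj₁ (even-before t t≤z₀))
  ...     | no t≰z₀ = subst OnTour (cong (cell 0) orbit≡c)
                         (proj₂ (even-after t (≰⇒> t≰z₀) t<half) ⟫ rightK-1⇝hub ,
                          hub⇝extra ⟫ proj₁ (even-after t (≰⇒> t≰z₀) t<half))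
  on-tour-diagonal₀ c c<n | suc (suc _) | s≤s (s≤s ())

  on-tour : ∀ x → Filled A x → OnTour x
  on-tour x filled with filled-cell x filled
  ... | inj₁ refl = on-tour-extra
  ... | inj₂ (zero , _ , c , c<n , refl) = on-tour-diagonal₀ c c<n
  ... | inj₂ (suc d , d<K , c , c<n , refl) = on-tour-band d c d<K c<n

  solution : IsSolution A allPlus (colSigns (suc L))
  solution x y x-filled y-filled = proj₁ (on-tour x x-filled) ⟫ proj₂ (on-tour y y-filled)

%-pred : ∀ m r d .{{_ : NonZero d}} → suc m % d ≡ suc r → m % d ≡ r
%-pred m r d m+1≡r+1 = ≤-antisym
  ([1+m%d]≤1+n⇒[m%d]≤n m r d (subst (0 <_) (sym m+1≡r+1) z<s) (≤-reflexive m+1≡r+1))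
  (m<[1+n%d]⇒m≤[n%d] m d (subst (r <_) (sym m+1≡r+1) ≤-refl))

even⇒2≤ : ∀ L → 1 ≤ L → L % 2 ≡ 0 → 2 ≤ L
even⇒2≤ (suc zero) _ ()
even⇒2≤ (suc (suc L)) _ _ = s≤s (s≤s z≤n)

proposition5p9 : (n k ℓ : ℕ) .{{_ : NonZero n}} (A : Array n) →
    k % 4 ≡ 3 → StandardForm k ℓ A → ℓ % 2 ≡ 1 → gcd n (k ∸ 1) ≡ 2 →
    IsSolution A allPlus (colSigns ℓ)
proposition5p9 n zero ℓ A () _ _ _
proposition5p9 n (suc K) zero A _ (_ , () , _) _ _
proposition5p9 n (suc K) (suc L) A k≡3[4] (k<n , 2≤ℓ , ℓ≤n-k+1 , filled-iff) ℓ-odd gcd≡2 =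
  Tour.solution n K T L {{>-nonZero (<-trans z<s k<n)}} A filled-iff T+K≡n L<T (even⇒2≤ L (s≤s⁻¹ 2≤ℓ) L-even)
    (%-pred K 2 4 k≡3[4]) L-even (trans (gcd-complement T+K≡n) gcd≡2)
  where
  T = n ∸ K
  L-even : L % 2 ≡ 0
  L-even = %-pred L 0 2 ℓ-odd
  T+K≡n : T + K ≡ n
  T+K≡n = m∸n+n≡m (<⇒≤ (<-trans (n<1+n K) k<n))
  -- ℓ ≤ n - k + 1 means L ≤ n - (K + 1) < n - K.
  L<T : L < T
  L<T = subst (suc L ≤_) (trans (+-comm (n ∸ suc K) 1) (sym (+-∸-assoc 1 (<⇒≤ k<n)))) ℓ≤n-k+1
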